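{- For every $\mathrm{CAU}^-_\sigma$ term $M$, $\mathrm{er}(M)\to^*_{\sigma\tau}\mathrm{Er}(M)$ and $\mathrm{tl}(M)\to^*_{\sigma\tau}\mathrm{Tl}(M)$, where $\to^*_{\sigma\tau}$ is the reflexive-transitive closure of $\to_\sigma\cup\to_\tau$.
   Context: The calculus $\mathrm{CAU}^-_\sigma$ uses nameless (de Bruijn) syntax: Terms $M,N ::= 1 \mid \lambda.M \mid M\,N \mid \mathsf{let}(M,N) \mid !_q M \mid q \triangleright M \mid \iota(\vartheta) \mid M[s] \mid \mathrm{er}(M)$; Trails $q ::= \mathsf{r} \mid \mathsf{t}(q,q') \mid \mathsf{ba} \mid \mathsf{bb} \mid \mathsf{ti} \mid \mathsf{lam}(q) \mid \mathsf{app}(q,q') \mid \mathsf{let}(q,q') \mid \mathsf{tr}(\zeta) \mid \mathrm{tl}(M)$; Substitutions $s,t ::= \langle\rangle \mid {\uparrow} \mid M\cdot s \mid s\circ t$. $\lambda$ binds index 1 of its body; $\mathsf{let}(M,N)$ binds index 1 in $N$; $\vartheta$ (resp. $\zeta$) is a family of nine terms (resp. trails) indexed by the constructors $\mathsf{r},\mathsf{t},\mathsf{ba},\mathsf{bb},\mathsf{ti},\mathsf{lam},\mathsf{app},\mathsf{let},\mathsf{tr}$. $\mathrm{er}$ is explicit trail erasure and $\mathrm{tl}$ explicit trail extraction. ${\uparrow}^n={\uparrow}\circ\cdots\circ{\uparrow}$. $\sigma$-rules: $1[\langle\rangle]\to 1$; $1[M\cdot s]\to M$; $(\lambda.M)[s]\to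 \lambda.(M[1\cdot(s\circ{\uparrow})])$; $(M\,N)[s]\to M[s]\,N[s]$; $(!_qM)[s]\to !_q(M[s])$; $\mathsf{let}(M,N)[s]\to\mathsf{let}(M[s],N[1\cdot(s\circ{\uparrow})])$; $(q\triangleright M)[s]\to q\triangleright(M[s])$; $\iota(\{M_i\})[s]\to\iota(\{M_i[s]\})$; $M[s][t]\to M[s\circ t]$; $\langle\rangle\circ s\to s$; ${\uparrow}\circ\langle\rangle\to{\uparrow}$; ${\uparrow}\circ(M\cdot s)\to s$; $(M\cdot s)\circ t\to M[t]\cdot(s\circ t)$; $(s_1\circ s_2)\circ s_3\to s_1\circ(s_2\circ s_3)$; $\mathrm{er}(1)\to 1$; $\mathrm{er}(1[{\uparrow}^n])\to 1[{\uparrow}^n]$; $\mathrm{er}(\lambda.M)\to\lambda.\mathrm{er}(M)$; $\mathrm{er}(M\,N)\to\mathrm{er}(M)\,\mathrm{er}(N)$; $\mathrm{er}(!_qM)\to !_qM$; $\mathrm{er}(\mathsf{let}(M,N))\to\mathsf{let}(\mathrm{er}(M),\mathrm{er}(N))$; $\mathrm{er}(q\triangleright M)\to\mathrm{er}(M)$; $\mathrm{er}(\iota(\{M_i\}))\to\iota(\{\mathrm{er}(M_i)\})$; $\mathrm{tl}(1)\to\mathsf{r}$; $\mathrm{tl}(1[{\uparrow}^n])\to\mathsf{r}$; $\mathrm{tl}(\lambda.M)\to\mathsf{lam}(\mathrm{tl}(M))$; $\mathrm{tl}(M\,N)\to\mathsf{app}(\mathrm{tl}(M),\mathrm{tl}(N))$;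 $\mathrm{tl}(!_qM)\to\mathsf{r}$; $\mathrm{tl}(\mathsf{let}(M,N))\to\mathsf{let}(\mathrm{tl}(M),\mathrm{tl}(N))$; $\mathrm{tl}(q\triangleright M)\to\mathsf{t}(q,\mathrm{tl}(M))$; $\mathrm{tl}(\iota(\{M_i\}))\to\mathsf{tr}(\{\mathrm{tl}(M_i)\})$. $\tau$-rules: $\mathsf{r}\triangleright M\to M$; $q\triangleright(q'\triangleright M)\to\mathsf{t}(q,q')\triangleright M$; $!_q(q'\triangleright M)\to !_{\mathsf{t}(q,q')}M$; $\lambda.(q\triangleright M)\to\mathsf{lam}(q)\triangleright\lambda.M$; $(q\triangleright M)\,N\to\mathsf{app}(q,\mathsf{r})\triangleright M\,N$; $M\,(q\triangleright N)\to\mathsf{app}(\mathsf{r},q)\triangleright M\,N$; $\mathsf{let}(q\triangleright M,N)\to\mathsf{let}(q,\mathsf{r})\triangleright\mathsf{let}(M,N)$; $\mathsf{let}(M,q\triangleright N)\to\mathsf{let}(\mathsf{r},q)\triangleright\mathsf{let}(M,N)$; $\iota(\{M_1,\dots,q\triangleright M_i,\dots,M_9\})\to\mathsf{tr}(\{\mathsf{r},\dots,q,\dots,\mathsf{r}\})\triangleright\iota(\{M_1,\dots,M_9\})$; $\mathsf{t}(q,\mathsf{r})\to q$; $\mathsf{t}(\mathsf{r},q)\to q$; $\mathsf{tr}(\{\mathsf{r},\dots,\mathsf{r}\})\to\mathsf{r}$; $\mathsf{app}(\mathsf{r},\mathsf{r})\to\mathsf{r}$; $\mathsf{lam}(\mathsf{r})\to\mathsf{r}$;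 $\mathsf{let}(\mathsf{r},\mathsf{r})\to\mathsf{r}$; $\mathsf{t}(\mathsf{t}(q_1,q_2),q_3)\to\mathsf{t}(q_1,\mathsf{t}(q_2,q_3))$; $\mathsf{t}(\mathsf{lam}(q),\mathsf{lam}(q'))\to\mathsf{lam}(\mathsf{t}(q,q'))$; $\mathsf{t}(\mathsf{lam}(q_1),\mathsf{t}(\mathsf{lam}(q_1'),q))\to\mathsf{t}(\mathsf{lam}(\mathsf{t}(q_1,q_1')),q)$; $\mathsf{t}(\mathsf{app}(q_1,q_2),\mathsf{app}(q_1',q_2'))\to\mathsf{app}(\mathsf{t}(q_1,q_1'),\mathsf{t}(q_2,q_2'))$; $\mathsf{t}(\mathsf{app}(q_1,q_2),\mathsf{t}(\mathsf{app}(q_1',q_2'),q))\to\mathsf{t}(\mathsf{app}(\mathsf{t}(q_1,q_1'),\mathsf{t}(q_2,q_2')),q)$; the same two with $\mathsf{let}$ for $\mathsf{app}$; $\mathsf{t}(\mathsf{tr}(\{q_i\}),\mathsf{tr}(\{q_i'\}))\to\mathsf{tr}(\{\mathsf{t}(q_i,q_i')\})$; $\mathsf{t}(\mathsf{tr}(\{q_i\}),\mathsf{t}(\mathsf{tr}(\{q_i'\}),q))\to\mathsf{t}(\mathsf{tr}(\{\mathsf{t}(q_i,q_i')\}),q)$. Both rule sets apply anywhere; $\sigma\cup\tau$ is terminating and confluent and $\sigma\tau(X)$ is the normal form. Meta-level projections: $\mathrm{Er}(M)=M'$ if $\sigma\tau(M)=q\triangleright M'$, and $\mathrm{Er}(M)=\sigma\tau(M)$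 otherwise; $\mathrm{Tl}(M)=q$ if $\sigma\tau(M)=q\triangleright M'$, and $\mathrm{Tl}(M)=\mathsf{r}$ otherwise. -}

module Defs where

open import Data.Nat using (ℕ; zero; suc)
open import Data.Fin using (Fin)
open import Data.Vec using (Vec; lookup; replicate; zipWith; _[_]≔_) renaming (map to vmap)
open import Data.Product using (Σ; _×_)
open import Relation.Nullary using (¬_)
open import Relation.Binary.Construct.Closure.ReflexiveTransitive using (Star)

-- Families ϑ / ζ of nine components are vectors of length 9, indexed (via Fin 9)
-- in the order r, t, ba, bb, ti, lam, app, let, tr.

infixl 7 _·_
infixr 5 _▷_ _∷ₛ_
infixr 6 _∘ₛ_

mutual
  data Term : Set where
    one   : Term                       -- de Bruijn index 1
    ƛ     : Term → Term
    _·_   : Term → Term → Term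
    lett  : Term → Term → Term         -- let(M,N), binds index 1 in N
    bang  : Trail → Term → Term
    _▷_   : Trail → Term → Term
    ι     : Vec Term 9 → Term
    _⟦_⟧  : Term → Subst → Term
    er    : Term → Term                -- explicit trail erasure

  data Trail : Set where
    r    : Trail
    t    : Trail → Trail → Trail
    ba   : Trail
    bb   : Trail
    ti   : Trail
    lamT : Trail → Trail
    appT : Trail → Trail → Trail
    letT : Trail → Trail → Trail
    tr   : Vec Trail 9 → Trail
    tl   : Term → Trail                -- explicit trail extraction

  data Subst : Set where
    ⟨⟩    : Subst
    ↑     : Subst
    _∷ₛ_  : Term → Subst → Subst
    _∘ₛ_  : Subst → Subst → Subst

-- ↑^(n+1) = ↑ ∘ (↑ ∘ ( ... ∘ ↑))   (n+1 copies; n ≥ 1 in the paper's notation ↑^n)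
↑^1+ : ℕ → Subst
↑^1+ zero    = ↑
↑^1+ (suc n) = ↑ ∘ₛ ↑^1+ n

rs : Vec Trail 9
rs = replicate 9 r

infix 4 _⟶_ _⟶q_ _⟶s_

mutual
  data _⟶_ : Term → Term → Set where
    σ-1⟨⟩   : one ⟦ ⟨⟩ ⟧ ⟶ one
    σ-1cons : ∀ {M s} → one ⟦ M ∷ₛ s ⟧ ⟶ M
    σ-lam   : ∀ {M s} → (ƛ M) ⟦ s ⟧ ⟶ ƛ (M ⟦ one ∷ₛ (s ∘ₛ ↑) ⟧)
    σ-app   : ∀ {M N s} → (M · N) ⟦ s ⟧ ⟶ (M ⟦ s ⟧) · (N ⟦ s ⟧)
    σ-bang  : ∀ {q M s} → (bang q M) ⟦ s ⟧ ⟶ bang q (M ⟦ s ⟧)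
    σ-let   : ∀ {M N s} → (lett M N) ⟦ s ⟧ ⟶ lett (M ⟦ s ⟧) (N ⟦ one ∷ₛ (s ∘ₛ ↑) ⟧)
    σ-tr    : ∀ {q M s} → (q ▷ M) ⟦ s ⟧ ⟶ q ▷ (M ⟦ s ⟧)
    σ-ι     : ∀ {ϑ s} → (ι ϑ) ⟦ s ⟧ ⟶ ι (vmap (λ M → M ⟦ s ⟧) ϑ)
    σ-clos  : ∀ {M s s′} → (M ⟦ s ⟧) ⟦ s′ ⟧ ⟶ M ⟦ s ∘ₛ s′ ⟧
    er-1    : er one ⟶ one
    er-1↑   : ∀ {n} → er (one ⟦ ↑^1+ n ⟧) ⟶ one ⟦ ↑^1+ n ⟧
    er-lam  : ∀ {M} → er (ƛ M) ⟶ ƛ (er M)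
    er-app  : ∀ {M N} → er (M · N) ⟶ er M · er N
    er-bang : ∀ {q M} → er (bang q M) ⟶ bang q M
    er-let  : ∀ {M N} → er (lett M N) ⟶ lett (er M) (er N)
    er-tr   : ∀ {q M} → er (q ▷ M) ⟶ er M
    er-ι    : ∀ {ϑ} → er (ι ϑ) ⟶ ι (vmap er ϑ)
    τ-r     : ∀ {M} → r ▷ M ⟶ M
    τ-tt    : ∀ {q q′ M} → q ▷ (q′ ▷ M) ⟶ t q q′ ▷ M
    τ-bang  : ∀ {q q′ M} → bang q (q′ ▷ M) ⟶ bang (t q q′) M
    τ-lam   : ∀ {q M} → ƛ (q ▷ M) ⟶ lamT q ▷ ƛ M
    τ-appL  : ∀ {q M N} → (q ▷ M) · N ⟶ appT q r ▷ (M · N)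
    τ-appR  : ∀ {q M N} → M · (q ▷ N) ⟶ appT r q ▷ (M · N)
    τ-letL  : ∀ {q M N} → lett (q ▷ M) N ⟶ letT q r ▷ lett M N
    τ-letR  : ∀ {q M N} → lett M (q ▷ N) ⟶ letT r q ▷ lett M N
    τ-ι     : ∀ {ϑ i q M} → ι (ϑ [ i ]≔ (q ▷ M)) ⟶ tr (rs [ i ]≔ q) ▷ ι (ϑ [ i ]≔ M)
    c-lam   : ∀ {M M′} → M ⟶ M′ → ƛ M ⟶ ƛ M′
    c-appL  : ∀ {M M′ N} → M ⟶ M′ → M · N ⟶ M′ · N
    c-appR  : ∀ {M N N′} → N ⟶ N′ → M · N ⟶ M · N′
    c-letL  : ∀ {M M′ N} → M ⟶ M′ → lett M N ⟶ lett M′ N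
    c-letR  : ∀ {M N N′} → N ⟶ N′ → lett M N ⟶ lett M N′
    c-bangq : ∀ {q q′ M} → q ⟶q q′ → bang q M ⟶ bang q′ M
    c-bangM : ∀ {q M M′} → M ⟶ M′ → bang q M ⟶ bang q M′
    c-trq   : ∀ {q q′ M} → q ⟶q q′ → q ▷ M ⟶ q′ ▷ M
    c-trM   : ∀ {q M M′} → M ⟶ M′ → q ▷ M ⟶ q ▷ M′
    c-ι     : ∀ {ϑ i M′} → lookup ϑ i ⟶ M′ → ι ϑ ⟶ ι (ϑ [ i ]≔ M′)
    c-subM  : ∀ {M M′ s} → M ⟶ M′ → M ⟦ s ⟧ ⟶ M′ ⟦ s ⟧
    c-subs  : ∀ {M s s′} → s ⟶s s′ → M ⟦ s ⟧ ⟶ M ⟦ s′ ⟧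
    c-er    : ∀ {M M′} → M ⟶ M′ → er M ⟶ er M′

  data _⟶q_ : Trail → Trail → Set where
    tl-1    : tl one ⟶q r
    tl-1↑   : ∀ {n} → tl (one ⟦ ↑^1+ n ⟧) ⟶q r
    tl-lam  : ∀ {M} → tl (ƛ M) ⟶q lamT (tl M)
    tl-app  : ∀ {M N} → tl (M · N) ⟶q appT (tl M) (tl N)
    tl-bang : ∀ {q M} → tl (bang q M) ⟶q r
    tl-let  : ∀ {M N} → tl (lett M N) ⟶q letT (tl M) (tl N)
    tl-tr   : ∀ {q M} → tl (q ▷ M) ⟶q t q (tl M)
    tl-ι    : ∀ {ϑ} → tl (ι ϑ) ⟶q tr (vmap tl ϑ)
    τ-tr    : ∀ {q} → t q r ⟶q q
    τ-tl    : ∀ {q} → t r q ⟶q q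
    τ-trr   : tr rs ⟶q r
    τ-appr  : appT r r ⟶q r
    τ-lamr  : lamT r ⟶q r
    τ-letr  : letT r r ⟶q r
    τ-assoc : ∀ {q₁ q₂ q₃} → t (t q₁ q₂) q₃ ⟶q t q₁ (t q₂ q₃)
    τ-lamlam  : ∀ {q q′} → t (lamT q) (lamT q′) ⟶q lamT (t q q′)
    τ-lamlam′ : ∀ {q₁ q₁′ q} → t (lamT q₁) (t (lamT q₁′) q) ⟶q t (lamT (t q₁ q₁′)) q
    τ-appapp  : ∀ {q₁ q₂ q₁′ q₂′} → t (appT q₁ q₂) (appT q₁′ q₂′) ⟶q appT (t q₁ q₁′) (t q₂ q₂′)
    τ-appapp′ : ∀ {q₁ q₂ q₁′ q₂′ q} →
                t (appT q₁ q₂) (t (appT q₁′ q₂′) q) ⟶q t (appT (t q₁ q₁′) (t q₂ q₂′)) q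
    τ-letlet  : ∀ {q₁ q₂ q₁′ q₂′} → t (letT q₁ q₂) (letT q₁′ q₂′) ⟶q letT (t q₁ q₁′) (t q₂ q₂′)
    τ-letlet′ : ∀ {q₁ q₂ q₁′ q₂′ q} →
                t (letT q₁ q₂) (t (letT q₁′ q₂′) q) ⟶q t (letT (t q₁ q₁′) (t q₂ q₂′)) q
    τ-trtr    : ∀ {ζ ζ′} → t (tr ζ) (tr ζ′) ⟶q tr (zipWith t ζ ζ′)
    τ-trtr′   : ∀ {ζ ζ′ q} → t (tr ζ) (t (tr ζ′) q) ⟶q t (tr (zipWith t ζ ζ′)) q
    c-tL    : ∀ {q q₁ q′} → q ⟶q q₁ → t q q′ ⟶q t q₁ q′
    c-tR    : ∀ {q q′ q₁} → q′ ⟶q q₁ → t q q′ ⟶q t q q₁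
    c-lamT  : ∀ {q q′} → q ⟶q q′ → lamT q ⟶q lamT q′
    c-appTL : ∀ {q q₁ q′} → q ⟶q q₁ → appT q q′ ⟶q appT q₁ q′
    c-appTR : ∀ {q q′ q₁} → q′ ⟶q q₁ → appT q q′ ⟶q appT q q₁
    c-letTL : ∀ {q q₁ q′} → q ⟶q q₁ → letT q q′ ⟶q letT q₁ q′
    c-letTR : ∀ {q q′ q₁} → q′ ⟶q q₁ → letT q q′ ⟶q letT q q₁
    c-tr    : ∀ {ζ i q′} → lookup ζ i ⟶q q′ → tr ζ ⟶q tr (ζ [ i ]≔ q′)
    c-tl    : ∀ {M M′} → M ⟶ M′ → tl M ⟶q tl M′

  data _⟶s_ : Subst → Subst → Set where
    σ-id∘   : ∀ {s} → ⟨⟩ ∘ₛ s ⟶s s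
    σ-↑⟨⟩   : ↑ ∘ₛ ⟨⟩ ⟶s ↑
    σ-↑cons : ∀ {M s} → ↑ ∘ₛ (M ∷ₛ s) ⟶s s
    σ-map   : ∀ {M s s′} → (M ∷ₛ s) ∘ₛ s′ ⟶s (M ⟦ s′ ⟧) ∷ₛ (s ∘ₛ s′)
    σ-ass   : ∀ {s₁ s₂ s₃} → (s₁ ∘ₛ s₂) ∘ₛ s₃ ⟶s s₁ ∘ₛ (s₂ ∘ₛ s₃)
    c-consM : ∀ {M M′ s} → M ⟶ M′ → M ∷ₛ s ⟶s M′ ∷ₛ s
    c-conss : ∀ {M s s′} → s ⟶s s′ → M ∷ₛ s ⟶s M ∷ₛ s′
    c-∘L    : ∀ {s s₁ s′} → s ⟶s s₁ → s ∘ₛ s′ ⟶s s₁ ∘ₛ s′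
    c-∘R    : ∀ {s s′ s₁} → s′ ⟶s s₁ → s ∘ₛ s′ ⟶s s ∘ₛ s₁

_⟶*_ : Term → Term → Set
_⟶*_ = Star _⟶_

_⟶q*_ : Trail → Trail → Set
_⟶q*_ = Star _⟶q_

Normal : Term → Set
Normal N = ∀ N′ → ¬ (N ⟶ N′)

-- "N is the σ∪τ-normal form of M", i.e. N = στ(M)
-- (unique and existent, since σ ∪ τ is terminating and confluent).
IsNF : Term → Term → Set
IsNF M N = M ⟶* N × Normal N

-- Er / Tl read off from the normal form στ(M)
erOfNF : Term → Term
erOfNF (q ▷ M′) = M′
erOfNF N        = N

tlOfNF : Term → Trail
tlOfNF (q ▷ M′) = q
tlOfNF N        = r

module Submission where

-- In a σ∪τ-normal form every trail ▷ has been pushed either to the root or into a !,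
-- and every closure M[s] has been resolved to an index 1[↑ⁿ].  Below the root such a
-- normal form is therefore built from 1, 1[↑ⁿ], λ, application, let, ! and ι alone,
-- on which er acts as the identity and tl produces only reflexivity trails r.  Since
-- er and tl are compatible with reduction, er M and tl M reduce to er and tl of στ(M),
-- where the root trail is dropped, respectively kept.

open import Defs
open import Data.Empty using (⊥-elim)
open import Data.Fin using (zero; suc)
open import Data.Nat using (suc)
open import Data.Product using (_×_; _,_; ∃; proj₂)
open import Data.Sum using (_⊎_; inj₁; inj₂)
open import Data.Vec using (Vec; []; _∷_; lookup; replicate; _[_]≔_) renaming (map to vmap)
open import Data.Vec.Properties using ([]≔-lookup)
open import Data.Vec.Relation.Unary.All using (All; []; _∷_)
open import Data.Vec.Relation.Binary.Pointwise.Inductive using (Pointwise; []; _∷_)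
open import Relation.Nullary using (¬_)
open import Relation.Binary.PropositionalEquality using (_≡_; _≢_; refl; sym; trans; cong; subst)
open import Relation.Binary.Construct.Closure.ReflexiveTransitive
  using (Star; ε; _◅_; _◅◅_; gmap; return)

Untrailed : Term → Set
Untrailed N = ∀ q M → N ≢ q ▷ M

normal-in : ∀ (C : Term → Term) {M} → (∀ {M M′} → M ⟶ M′ → C M ⟶ C M′) →
            Normal (C M) → Normal M
normal-in C cong-C nf _ step = nf _ (cong-C step)

normal-untrailed-in : ∀ (C : Term → Term) {M} →
                      (∀ {M M′} → M ⟶ M′ → C M ⟶ C M′) →
                      (∀ {q M} → ∃ λ N → C (q ▷ M) ⟶ N) →
                      Normal (C M) → Normal M × Untrailed M
normal-untrailed-in C cong-C τ-C nf =
  normal-in C cong-C nf , λ { q M refl → nf _ (proj₂ τ-C) }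

normal-ι-component : ∀ {ϑ} → Normal (ι ϑ) → ∀ i →
                     Normal (lookup ϑ i) × Untrailed (lookup ϑ i)
normal-ι-component {ϑ} nf i = (λ _ step → nf _ (c-ι step)) , untrailed
  where
  untrailed : Untrailed (lookup ϑ i)
  untrailed q M eq =
    nf _ (subst (λ v → ι v ⟶ tr (rs [ i ]≔ q) ▷ ι (ϑ [ i ]≔ M)) ϑ[i]≔q▷M≡ϑ τ-ι)
    where
    ϑ[i]≔q▷M≡ϑ : ϑ [ i ]≔ (q ▷ M) ≡ ϑ
    ϑ[i]≔q▷M≡ϑ = trans (cong (ϑ [ i ]≔_) (sym eq)) ([]≔-lookup ϑ i)

∘ₛ-reducible⊎↑^1+ : ∀ s₁ s₂ → (∃ λ s → s₁ ∘ₛ s₂ ⟶s s) ⊎ (∃ λ n → s₁ ∘ₛ s₂ ≡ ↑^1+ n)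
∘ₛ-reducible⊎↑^1+ ⟨⟩         s₂         = inj₁ (_ , σ-id∘)
∘ₛ-reducible⊎↑^1+ (M ∷ₛ s)   s₂         = inj₁ (_ , σ-map)
∘ₛ-reducible⊎↑^1+ (s₁ ∘ₛ s₂) s₃         = inj₁ (_ , σ-ass)
∘ₛ-reducible⊎↑^1+ ↑          ⟨⟩         = inj₁ (_ , σ-↑⟨⟩)
∘ₛ-reducible⊎↑^1+ ↑          (M ∷ₛ s)   = inj₁ (_ , σ-↑cons)
∘ₛ-reducible⊎↑^1+ ↑          ↑          = inj₂ (1 , refl)
∘ₛ-reducible⊎↑^1+ ↑          (s₁ ∘ₛ s₂) with ∘ₛ-reducible⊎↑^1+ s₁ s₂
... | inj₁ (_ , step) = inj₁ (_ , c-∘R step)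
... | inj₂ (n , eq)   = inj₂ (suc n , cong (↑ ∘ₛ_) eq)

mutual
  ¬normal-er : ∀ M → ¬ Normal (er M)
  ¬normal-er one        nf = nf _ er-1
  ¬normal-er (ƛ M)      nf = nf _ er-lam
  ¬normal-er (M · N)    nf = nf _ er-app
  ¬normal-er (lett M N) nf = nf _ er-let
  ¬normal-er (bang q M) nf = nf _ er-bang
  ¬normal-er (q ▷ M)    nf = nf _ er-tr
  ¬normal-er (ι ϑ)      nf = nf _ er-ι
  ¬normal-er (M ⟦ s ⟧)  nf with normal-closure⇒shift M s (normal-in er c-er nf)
  ... | refl , _ , refl = nf _ er-1↑
  ¬normal-er (er M)     nf = ¬normal-er M (normal-in er c-er nf)

  normal-closure⇒shift : ∀ M s → Normal (M ⟦ s ⟧) → M ≡ one × ∃ λ n → s ≡ ↑^1+ n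
  normal-closure⇒shift one ↑          nf = refl , 0 , refl
  normal-closure⇒shift one ⟨⟩         nf = ⊥-elim (nf _ σ-1⟨⟩)
  normal-closure⇒shift one (M ∷ₛ s)   nf = ⊥-elim (nf _ σ-1cons)
  normal-closure⇒shift one (s₁ ∘ₛ s₂) nf with ∘ₛ-reducible⊎↑^1+ s₁ s₂
  ... | inj₁ (_ , step) = ⊥-elim (nf _ (c-subs step))
  ... | inj₂ (n , eq)   = refl , n , eq
  normal-closure⇒shift (ƛ M)      s nf = ⊥-elim (nf _ σ-lam)
  normal-closure⇒shift (M · N)    s nf = ⊥-elim (nf _ σ-app)
  normal-closure⇒shift (lett M N) s nf = ⊥-elim (nf _ σ-let)
  normal-closure⇒shift (bang q M) s nf = ⊥-elim (nf _ σ-bang)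
  normal-closure⇒shift (q ▷ M)    s nf = ⊥-elim (nf _ σ-tr)
  normal-closure⇒shift (ι ϑ)      s nf = ⊥-elim (nf _ σ-ι)
  normal-closure⇒shift (M ⟦ s′ ⟧) s nf = ⊥-elim (nf _ σ-clos)
  normal-closure⇒shift (er M)     s nf = ⊥-elim (¬normal-er M (normal-in _⟦ s ⟧ c-subM nf))

data TrailFree : Term → Set where
  one   : TrailFree one
  shift : ∀ n → TrailFree (one ⟦ ↑^1+ n ⟧)
  ƛ     : ∀ {M} → TrailFree M → TrailFree (ƛ M)
  _·_   : ∀ {M N} → TrailFree M → TrailFree N → TrailFree (M · N)
  lett  : ∀ {M N} → TrailFree M → TrailFree N → TrailFree (lett M N)
  bang  : ∀ q M → TrailFree (bang q M)
  ι     : ∀ {ϑ} → All TrailFree ϑ → TrailFree (ι ϑ)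

mutual
  normal-untrailed⇒trailFree : ∀ N → Normal N × Untrailed N → TrailFree N
  normal-untrailed⇒trailFree one        _ = one
  normal-untrailed⇒trailFree (ƛ M)      (nf , _) =
    ƛ (normal-untrailed⇒trailFree M (normal-untrailed-in ƛ c-lam (_ , τ-lam) nf))
  normal-untrailed⇒trailFree (M · N)    (nf , _) =
    normal-untrailed⇒trailFree M (normal-untrailed-in (_· N) c-appL (_ , τ-appL) nf) ·
    normal-untrailed⇒trailFree N (normal-untrailed-in (M ·_) c-appR (_ , τ-appR) nf)
  normal-untrailed⇒trailFree (lett M N) (nf , _) = lett
    (normal-untrailed⇒trailFree M (normal-untrailed-in (λ M → lett M N) c-letL (_ , τ-letL) nf))
    (normal-untrailed⇒trailFree N (normal-untrailed-in (lett M) c-letR (_ , τ-letR) nf))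
  normal-untrailed⇒trailFree (bang q M) _ = bang q M
  normal-untrailed⇒trailFree (q ▷ M)    (_ , untrailed) = ⊥-elim (untrailed q M refl)
  normal-untrailed⇒trailFree (ι ϑ)      (nf , _) =
    ι (normal-untrailed⇒trailFree-all ϑ (normal-ι-component nf))
  normal-untrailed⇒trailFree (M ⟦ s ⟧)  (nf , _) with normal-closure⇒shift M s nf
  ... | refl , n , refl = shift n
  normal-untrailed⇒trailFree (er M)     (nf , _) = ⊥-elim (¬normal-er M nf)

  normal-untrailed⇒trailFree-all : ∀ {n} (ϑ : Vec Term n) →
    (∀ i → Normal (lookup ϑ i) × Untrailed (lookup ϑ i)) → All TrailFree ϑ
  normal-untrailed⇒trailFree-all []      _  = []
  normal-untrailed⇒trailFree-all (M ∷ ϑ) h =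
    normal-untrailed⇒trailFree M (h zero) ∷ normal-untrailed⇒trailFree-all ϑ (λ i → h (suc i))

pointwise-star-lift : ∀ {A B : Set} {R : A → A → Set} {S : B → B → Set} {n}
  (C : Vec A n → B) → (∀ v i {y} → R (lookup v i) y → S (C v) (C (v [ i ]≔ y))) →
  ∀ {u w} → Pointwise (Star R) u w → Star S (C u) (C w)
pointwise-star-lift C step [] = ε
pointwise-star-lift {R = R} {S} C step {x ∷ u} {y ∷ w} (x⟶*y ∷ u⟶*w) =
  head-star x⟶*y ◅◅ pointwise-star-lift (λ v → C (y ∷ v)) (λ v i → step (y ∷ v) (suc i)) u⟶*w
  where
  head-star : ∀ {a b} → Star R a b → Star S (C (a ∷ u)) (C (b ∷ u))
  head-star ε                = ε
  head-star {a} (a⟶c ◅ c⟶*b) = step (a ∷ u) zero a⟶c ◅ head-star c⟶*b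

mutual
  er-trailFree : ∀ {N} → TrailFree N → er N ⟶* N
  er-trailFree one        = return er-1
  er-trailFree (shift n)  = return er-1↑
  er-trailFree (ƛ M)      = er-lam ◅ gmap ƛ c-lam (er-trailFree M)
  er-trailFree (_·_ {M} {N} tfM tfN) = er-app ◅
    (gmap (_· er N) c-appL (er-trailFree tfM) ◅◅ gmap (M ·_) c-appR (er-trailFree tfN))
  er-trailFree (lett {M} {N} tfM tfN) = er-let ◅
    (gmap (λ M′ → lett M′ (er N)) c-letL (er-trailFree tfM) ◅◅
     gmap (lett M) c-letR (er-trailFree tfN))
  er-trailFree (bang q M) = return er-bang
  er-trailFree (ι tfϑ)    =
    er-ι ◅ pointwise-star-lift ι (λ _ _ step → c-ι step) (er-trailFree-all tfϑ)

  er-trailFree-all : ∀ {n} {ϑ : Vec Term n} → All TrailFree ϑ → Pointwise _⟶*_ (vmap er ϑ) ϑ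
  er-trailFree-all []           = []
  er-trailFree-all (tfM ∷ tfϑ)  = er-trailFree tfM ∷ er-trailFree-all tfϑ

mutual
  tl-trailFree : ∀ {N} → TrailFree N → tl N ⟶q* r
  tl-trailFree one        = return tl-1
  tl-trailFree (shift n)  = return tl-1↑
  tl-trailFree (ƛ M)      = tl-lam ◅ (gmap lamT c-lamT (tl-trailFree M) ◅◅ return τ-lamr)
  tl-trailFree (_·_ {M} {N} tfM tfN) = tl-app ◅
    (gmap (λ q → appT q (tl N)) c-appTL (tl-trailFree tfM) ◅◅
     gmap (appT r) c-appTR (tl-trailFree tfN) ◅◅ return τ-appr)
  tl-trailFree (lett {M} {N} tfM tfN) = tl-let ◅
    (gmap (λ q → letT q (tl N)) c-letTL (tl-trailFree tfM) ◅◅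
     gmap (letT r) c-letTR (tl-trailFree tfN) ◅◅ return τ-letr)
  tl-trailFree (bang q M) = return tl-bang
  tl-trailFree (ι tfϑ)    = tl-ι ◅
    (pointwise-star-lift tr (λ _ _ step → c-tr step) (tl-trailFree-all tfϑ) ◅◅ return τ-trr)

  tl-trailFree-all : ∀ {n} {ϑ : Vec Term n} → All TrailFree ϑ →
                     Pointwise _⟶q*_ (vmap tl ϑ) (replicate n r)
  tl-trailFree-all []           = []
  tl-trailFree-all (tfM ∷ tfϑ)  = tl-trailFree tfM ∷ tl-trailFree-all tfϑ

er-tl-trailFree : ∀ {N} → TrailFree N → er N ⟶* N × tl N ⟶q* r
er-tl-trailFree tfN = er-trailFree tfN , tl-trailFree tfN

er-tl-normal : ∀ N → Normal N → er N ⟶* erOfNF N × tl N ⟶q* tlOfNF N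
er-tl-normal (q ▷ M) nf with er-tl-trailFree (normal-untrailed⇒trailFree M
                                (normal-untrailed-in (q ▷_) c-trM (_ , τ-tt) nf))
... | er-M⟶*M , tl-M⟶*r = er-tr ◅ er-M⟶*M , tl-tr ◅ (gmap (t q) c-tR tl-M⟶*r ◅◅ return τ-tr)
er-tl-normal one        nf = er-tl-trailFree (normal-untrailed⇒trailFree _ (nf , λ _ _ ()))
er-tl-normal (ƛ M)      nf = er-tl-trailFree (normal-untrailed⇒trailFree _ (nf , λ _ _ ()))
er-tl-normal (M · N)    nf = er-tl-trailFree (normal-untrailed⇒trailFree _ (nf , λ _ _ ()))
er-tl-normal (lett M N) nf = er-tl-trailFree (normal-untrailed⇒trailFree _ (nf , λ _ _ ()))
er-tl-normal (bang q M) nf = er-tl-trailFree (normal-untrailed⇒trailFree _ (nf , λ _ _ ()))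
er-tl-normal (ι ϑ)      nf = er-tl-trailFree (normal-untrailed⇒trailFree _ (nf , λ _ _ ()))
er-tl-normal (M ⟦ s ⟧)  nf = er-tl-trailFree (normal-untrailed⇒trailFree _ (nf , λ _ _ ()))
er-tl-normal (er M)     nf = er-tl-trailFree (normal-untrailed⇒trailFree _ (nf , λ _ _ ()))

lemma4 : (M N : Term) → IsNF M N → (er M ⟶* erOfNF N) × (tl M ⟶q* tlOfNF N)
lemma4 M N (M⟶*N , nf) with er-tl-normal N nf
... | er-N⟶*Er , tl-N⟶*Tl = gmap er c-er M⟶*N ◅◅ er-N⟶*Er , gmap tl c-tl M⟶*N ◅◅ tl-N⟶*Tl
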